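{- Let $k,n\ge 0$ be integers and let $x_1,x_2,\ldots$ be indeterminates (or arbitrary real numbers). Define $f:\mathbb{N}\to\mathbb{Q}[x_1,x_2,\ldots]$ by $f(s)=\frac{x_s}{s!}$ for $s\in\{1,2,\ldots,n-k+1\}$ and $f(s)=0$ for $s=0$ and for all $s\ge n-k+2$. Then \[ \frac{k!}{n!}B_{n,k}(x_1,x_2,\ldots,x_{n-k+1})=\binom{k}{n}_f . \]
   Context: The $(n,k)$-th partial Bell polynomial is \[ B_{n,k}(x_1,\ldots,x_{n-k+1})=\sum \frac{n!}{\ell_1!\cdots\ell_{n-k+1}!}\Big(\frac{x_1}{1!}\Big)^{\ell_1}\cdots\Big(\frac{x_{n-k+1}}{(n-k+1)!}\Big)^{\ell_{n-k+1}}, \] the sum being over all nonnegative integers $\ell_1,\ldots,\ell_{n-k+1}$ with $\ell_1+2\ell_2+\cdots+(n-k+1)\ell_{n-k+1}=n$ and $\ell_1+\cdots+\ell_{n-k+1}=k$ (an empty sum is $0$). For a weight function $f$ on $\mathbb{N}=\{0,1,2,\ldots\}$ with values in a commutative ring, $\binom{k}{n}_f$ denotes the total weight of all $f$-weighted integer compositions of $n$ with $k$ parts, i.e. $\binom{k}{n}_f=\sum f(\pi_1)\cdots f(\pi_k)$ over all ordered $k$-tuples $(\pi_1,\ldots,\pi_k)$ of nonnegative integers with $\pi_1+\cdots+\pi_k=n$ (empty product $=1$, so $\binom{0}{0}_f=1$ and $\binom{0}{n}_f=0$ for $n>0$). -}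

module Defs where

open import Level using (Level)
open import Algebra.Bundles using (CommutativeRing)
open import Data.Nat using (ℕ; zero; suc; _∸_; _≤ᵇ_; pred; _≟_; _!)
import Data.Nat as N
open import Data.Bool using (Bool; true; false; if_then_else_; _∧_)
open import Data.List using (List; []; _∷_; concatMap; map; upTo; filterᵇ)
open import Data.Vec using (Vec; []; _∷_)
open import Relation.Nullary.Decidable using (does)

vecsUpTo : (m b : ℕ) → List (Vec ℕ m)
vecsUpTo zero    b = [] ∷ []
vecsUpTo (suc m) b = concatMap (λ i → map (i ∷_) (vecsUpTo m b)) (upTo (suc b))

vsum : ∀ {m} → Vec ℕ m → ℕ
vsum []       = 0
vsum (a ∷ as) = a N.+ vsum as

wsumFrom : ∀ {m} → ℕ → Vec ℕ m → ℕ
wsumFrom i []       = 0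
wsumFrom i (a ∷ as) = suc i N.* a N.+ wsumFrom (suc i) as

-- Number of variables of B_{n,k}: n - k + 1 as an integer, or 0 if n < k
-- (then B_{n,k} is an empty sum).
bellArity : ℕ → ℕ → ℕ
bellArity n k = if k ≤ᵇ n then suc (n ∸ k) else 0

-- Index set of B_{n,k}: (ℓ₁,…,ℓ_{n-k+1}) with Σ iℓᵢ = n and Σ ℓᵢ = k.
-- (Each ℓᵢ ≤ n automatically, so enumerating entries in {0..n} is exhaustive.)
bellIndices : (n k : ℕ) → List (Vec ℕ (bellArity n k))
bellIndices n k =
  filterᵇ (λ ℓs → does (wsumFrom 0 ℓs ≟ n)) (filterᵇ (λ ℓs → does (vsum ℓs ≟ k)) (vecsUpTo (bellArity n k) n))

-- Ordered k-tuples of naturals with sum n (each entry ≤ n automatically).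
compositions : (k n : ℕ) → List (Vec ℕ k)
compositions k n = filterᵇ (λ π → does (vsum π ≟ n)) (vecsUpTo k n)

module _ {c ℓ : Level} (R : CommutativeRing c ℓ) where
  open CommutativeRing R

  ι : ℕ → Carrier
  ι zero    = 0#
  ι (suc n) = 1# + ι n

  pow : Carrier → ℕ → Carrier
  pow a zero    = 1#
  pow a (suc e) = a * pow a e

  rsum : List Carrier → Carrier
  rsum []       = 0#
  rsum (a ∷ as) = a + rsum as

  module WithInverses (inv : ℕ → Carrier) where
    -- 1/a for a positive integer a (inv m is the inverse of m+1)
    recip : ℕ → Carrier
    recip a = inv (pred a)

    bellTermFrom : ∀ {m} → ℕ → (ℕ → Carrier) → Vec ℕ m → Carrier
    bellTermFrom j x []       = 1#
    bellTermFrom j x (l ∷ ls) =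
      (recip (l !) * pow (x (suc j) * recip (suc j !)) l) * bellTermFrom (suc j) x ls

    partialBell : (n k : ℕ) → (ℕ → Carrier) → Carrier
    partialBell n k x = rsum (map (λ ℓs → ι (n !) * bellTermFrom 0 x ℓs) (bellIndices n k))

    -- the weight f(s) = x_s / s! for 1 ≤ s ≤ n-k+1 (i.e. s + k ≤ n + 1), else 0
    fWeight : (n k : ℕ) → (ℕ → Carrier) → ℕ → Carrier
    fWeight n k x zero    = 0#
    fWeight n k x (suc s) =
      if suc s N.+ k ≤ᵇ suc n then x (suc s) * recip (suc s !) else 0#

  vprod : ∀ {m} → (ℕ → Carrier) → Vec ℕ m → Carrier
  vprod f []       = 1#
  vprod f (a ∷ as) = f a * vprod f as

  weightedCompositions : (f : ℕ → Carrier) (k n : ℕ) → Carrier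
  weightedCompositions f k n = rsum (map (vprod f) (compositions k n))

-- With y_s = x_s / s! and F(z) = y₁ z + ⋯ + y_{n-k+1} z^{n-k+1}, the weighted compositions of n
-- into k parts add up to the coefficient of zⁿ in Fᵏ, while B_{n,k}/n! is the coefficient of zⁿ in
-- the divided power γ_k(F) = Fᵏ/k! expanded multinomially, i.e. as a sum over multiplicities (ℓ_s)
-- of ∏ y_s^{ℓ_s}/ℓ_s!. Rather than counting arrangements, we check that this expansion satisfies
-- (k+1) γ_{k+1}(F) = F · γ_k(F), splitting off one variable at a time; the composition sums satisfy
-- C_{k+1} = F · C_k, so C_k = k! γ_k(F) by induction on k.
module Submission where

open import Defs
open import Level using (Level)
open import Algebra.Bundles using (CommutativeRing)
open import Data.Nat using (ℕ; zero; suc; pred; _!; _≤_; _<_; z≤n; s≤s; _≡ᵇ_; _∸_; _≤?_)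
import Data.Nat as ℕ
import Data.Nat.Properties as ℕₚ
open import Data.Nat.Properties
  using (≤-refl; ≤-trans; ≤-pred; <⇒≱; ≰⇒>; n≤1+n; m≤m+n; m≤n+m; m∸n≤m; m≤n⇒m∸n≡0; m+[n∸m]≡n;
         +-∸-assoc; m≤o∸n⇒m+n≤o; m+n≤o⇒m≤o∸n; +-suc; *-suc; *-zeroʳ; suc-pred; _!≢0)
open import Data.Bool using (Bool; true; false; if_then_else_)
open import Data.List using (List; []; _∷_; _++_; map; concatMap; applyUpTo; upTo; filterᵇ)
open import Data.List.Properties using (map-++; map-∘; map-cong)
open import Data.Vec using (Vec; []; _∷_)
open import Data.Sum using (_⊎_; inj₁; inj₂)
open import Function using (_∘_)
open import Relation.Nullary.Decidable using (yes; no; dec-true; dec-false)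
open import Relation.Nullary.Negation using (contradiction)
open import Relation.Binary.PropositionalEquality using (_≡_)
import Relation.Binary.PropositionalEquality as ≡

bellArity-≤ : ∀ {n k} → k ≤ n → bellArity n k ≡ suc (n ∸ k)
bellArity-≤ {n} {k} k≤n = ≡.cong (λ b → if b then suc (n ∸ k) else 0) (dec-true (k ≤? n) k≤n)

bellArity-> : ∀ {n k} → n < k → bellArity n k ≡ 0
bellArity-> {n} {k} n<k = ≡.cong (λ b → if b then suc (n ∸ k) else 0) (dec-false (k ≤? n) (<⇒≱ n<k))

≤⊎bellArity≡0 : ∀ n k → k ≤ n ⊎ bellArity n k ≡ 0
≤⊎bellArity≡0 n k with k ≤? n
... | yes k≤n = inj₁ k≤n
... | no  k≰n = inj₂ (bellArity-> (≰⇒> k≰n))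

<bellArity⇒+≤ : ∀ {n k i} → i < bellArity n k → i ℕ.+ k ≤ n
<bellArity⇒+≤ {n} {k} {i} i<M with k ≤? n
... | yes k≤n = m≤o∸n⇒m+n≤o i k≤n (≤-pred (≡.subst (i <_) (bellArity-≤ k≤n) i<M))
... | no  k≰n = contradiction (≡.subst (i <_) (bellArity-> (≰⇒> k≰n)) i<M) λ ()

+≤⇒<bellArity : ∀ {n k i} → i ℕ.+ k ≤ n → i < bellArity n k
+≤⇒<bellArity {n} {k} {i} i+k≤n =
  ≡.subst (i <_) (≡.sym (bellArity-≤ (≤-trans (m≤n+m k i) i+k≤n))) (s≤s (m+n≤o⇒m≤o∸n i i+k≤n))

module _ {c ℓ : Level} (R : CommutativeRing c ℓ) where
  open CommutativeRing R
  open import Algebra.Properties.CommutativeSemigroup +-commutativeSemigroup using (interchange)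
  open import Algebra.Properties.CommutativeSemigroup *-commutativeSemigroup
    using () renaming (x∙yz≈y∙xz to x*yz≈y*xz)
  open import Algebra.Properties.Semiring.Mult semiring using (_×_; ×-homo-+; ×1-homo-*)
  open import Relation.Binary.Reasoning.Setoid setoid

  ι≡×1 : ∀ n → ι R n ≡ n × 1#
  ι≡×1 zero    = ≡.refl
  ι≡×1 (suc n) = ≡.cong (1# +_) (ι≡×1 n)

  ι-+ : ∀ m n → ι R (m ℕ.+ n) ≈ ι R m + ι R n
  ι-+ m n = begin
    ι R (m ℕ.+ n)         ≡⟨ ι≡×1 (m ℕ.+ n) ⟩
    (m ℕ.+ n) × 1#        ≈⟨ ×-homo-+ 1# m n ⟩
    m × 1# + n × 1#       ≡⟨ ≡.sym (≡.cong₂ _+_ (ι≡×1 m) (ι≡×1 n)) ⟩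
    ι R m + ι R n         ∎

  ι-* : ∀ m n → ι R (m ℕ.* n) ≈ ι R m * ι R n
  ι-* m n = begin
    ι R (m ℕ.* n)         ≡⟨ ι≡×1 (m ℕ.* n) ⟩
    (m ℕ.* n) × 1#        ≈⟨ ×1-homo-* m n ⟩
    (m × 1#) * (n × 1#)   ≡⟨ ≡.sym (≡.cong₂ _*_ (ι≡×1 m) (ι≡×1 n)) ⟩
    ι R m * ι R n         ∎

  iverson : Bool → Carrier → Carrier
  iverson b z = if b then z else 0#

  iverson-cong : ∀ b {u v} → u ≈ v → iverson b u ≈ iverson b v
  iverson-cong true  u≈v = u≈v
  iverson-cong false u≈v = refl

  *-iverson : ∀ b u z → u * iverson b z ≈ iverson b (u * z)
  *-iverson true  u z = refl
  *-iverson false u z = zeroʳ u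

  *-iverson² : ∀ b₁ b₂ u z → u * iverson b₁ (iverson b₂ z) ≈ iverson b₁ (iverson b₂ (u * z))
  *-iverson² b₁ b₂ u z = trans (*-iverson b₁ u _) (iverson-cong b₁ (*-iverson b₂ u z))

  sumBelow : ℕ → (ℕ → Carrier) → Carrier
  sumBelow zero    F = 0#
  sumBelow (suc n) F = F 0 + sumBelow n (F ∘ suc)

  sumBelow-cong : ∀ n {F G : ℕ → Carrier} → (∀ i → i < n → F i ≈ G i) → sumBelow n F ≈ sumBelow n G
  sumBelow-cong zero    F≈G = refl
  sumBelow-cong (suc n) F≈G = +-cong (F≈G 0 (s≤s z≤n)) (sumBelow-cong n (λ i i<n → F≈G (suc i) (s≤s i<n)))

  sumBelow-zero : ∀ n {F : ℕ → Carrier} → (∀ i → i < n → F i ≈ 0#) → sumBelow n F ≈ 0#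
  sumBelow-zero zero    F≈0 = refl
  sumBelow-zero (suc n) F≈0 =
    trans (+-cong (F≈0 0 (s≤s z≤n)) (sumBelow-zero n (λ i i<n → F≈0 (suc i) (s≤s i<n)))) (+-identityˡ 0#)

  sumBelow-+ : ∀ n (F G : ℕ → Carrier) → sumBelow n (λ i → F i + G i) ≈ sumBelow n F + sumBelow n G
  sumBelow-+ zero    F G = sym (+-identityˡ 0#)
  sumBelow-+ (suc n) F G = trans (+-congˡ (sumBelow-+ n (F ∘ suc) (G ∘ suc))) (interchange _ _ _ _)

  *-distribˡ-sumBelow : ∀ n u (F : ℕ → Carrier) → u * sumBelow n F ≈ sumBelow n (λ i → u * F i)
  *-distribˡ-sumBelow zero    u F = zeroʳ u
  *-distribˡ-sumBelow (suc n) u F = trans (distribˡ u _ _) (+-congˡ (*-distribˡ-sumBelow n u (F ∘ suc)))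

  sumBelow-comm : ∀ m n (F : ℕ → ℕ → Carrier) →
    sumBelow m (λ i → sumBelow n (F i)) ≈ sumBelow n (λ j → sumBelow m (λ i → F i j))
  sumBelow-comm zero    n F = sym (sumBelow-zero n (λ _ _ → refl))
  sumBelow-comm (suc m) n F = trans (+-congˡ (sumBelow-comm m n (F ∘ suc))) (sym (sumBelow-+ n (F 0) _))

  sumBelow-truncate : ∀ {m n} (F : ℕ → Carrier) → m ≤ n → (∀ i → m ≤ i → i < n → F i ≈ 0#) →
    sumBelow n F ≈ sumBelow m F
  sumBelow-truncate F z≤n       F≈0 = sumBelow-zero _ (λ i → F≈0 i z≤n)
  sumBelow-truncate F (s≤s m≤n) F≈0 =
    +-congˡ (sumBelow-truncate (F ∘ suc) m≤n (λ i m≤i i<n → F≈0 (suc i) (s≤s m≤i) (s≤s i<n)))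

  rsum-++ : ∀ xs ys → rsum R (xs ++ ys) ≈ rsum R xs + rsum R ys
  rsum-++ []       ys = sym (+-identityˡ _)
  rsum-++ (x ∷ xs) ys = trans (+-congˡ (rsum-++ xs ys)) (sym (+-assoc _ _ _))

  rsum-concatMap : ∀ {A B : Set} (G : B → Carrier) (h : A → List B) (as : List A) →
    rsum R (map G (concatMap h as)) ≈ rsum R (map (λ a → rsum R (map G (h a))) as)
  rsum-concatMap G h []       = refl
  rsum-concatMap G h (a ∷ as) = begin
    rsum R (map G (h a ++ concatMap h as))           ≡⟨ ≡.cong (rsum R) (map-++ G (h a) (concatMap h as)) ⟩
    rsum R (map G (h a) ++ map G (concatMap h as))   ≈⟨ rsum-++ (map G (h a)) _ ⟩
    rsum R (map G (h a)) + rsum R (map G (concatMap h as)) ≈⟨ +-congˡ (rsum-concatMap G h as) ⟩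
    rsum R (map G (h a)) + rsum R (map (λ a → rsum R (map G (h a))) as) ∎

  rsum-applyUpTo : ∀ (F : ℕ → Carrier) h n → rsum R (map F (applyUpTo h n)) ≈ sumBelow n (F ∘ h)
  rsum-applyUpTo F h zero    = refl
  rsum-applyUpTo F h (suc n) = +-congˡ (rsum-applyUpTo F (h ∘ suc) n)

  rsum-cong : ∀ {A : Set} {F G : A → Carrier} as → (∀ a → F a ≈ G a) → rsum R (map F as) ≈ rsum R (map G as)
  rsum-cong []       F≈G = refl
  rsum-cong (a ∷ as) F≈G = +-cong (F≈G a) (rsum-cong as F≈G)

  *-distribˡ-rsum : ∀ {A : Set} u (F : A → Carrier) as → u * rsum R (map F as) ≈ rsum R (map (λ a → u * F a) as)
  *-distribˡ-rsum u F []       = zeroʳ u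
  *-distribˡ-rsum u F (a ∷ as) = trans (distribˡ u _ _) (+-congˡ (*-distribˡ-rsum u F as))

  rsum-filterᵇ : ∀ {A : Set} (p : A → Bool) (F : A → Carrier) as →
    rsum R (map F (filterᵇ p as)) ≈ rsum R (map (λ a → iverson (p a) (F a)) as)
  rsum-filterᵇ p F []       = refl
  rsum-filterᵇ p F (a ∷ as) with p a
  ... | true  = +-congˡ (rsum-filterᵇ p F as)
  ... | false = trans (rsum-filterᵇ p F as) (sym (+-identityˡ _))

  rsum-vecsUpTo-suc : ∀ m b (G : Vec ℕ (suc m) → Carrier) →
    rsum R (map G (vecsUpTo (suc m) b)) ≈ sumBelow (suc b) (λ i → rsum R (map (G ∘ (i ∷_)) (vecsUpTo m b)))
  rsum-vecsUpTo-suc m b G = begin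
    rsum R (map G (concatMap (λ i → map (i ∷_) (vecsUpTo m b)) (upTo (suc b))))
      ≈⟨ rsum-concatMap G (λ i → map (i ∷_) (vecsUpTo m b)) (upTo (suc b)) ⟩
    rsum R (map (λ i → rsum R (map G (map (i ∷_) (vecsUpTo m b)))) (upTo (suc b)))
      ≈⟨ rsum-cong (upTo (suc b)) (λ i → reflexive (≡.cong (rsum R) (≡.sym (map-∘ (vecsUpTo m b))))) ⟩
    rsum R (map (λ i → rsum R (map (G ∘ (i ∷_)) (vecsUpTo m b))) (upTo (suc b)))
      ≈⟨ rsum-applyUpTo (λ i → rsum R (map (G ∘ (i ∷_)) (vecsUpTo m b))) (λ i → i) (suc b) ⟩
    sumBelow (suc b) (λ i → rsum R (map (G ∘ (i ∷_)) (vecsUpTo m b))) ∎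

  -- A sequence g : ℕ → Carrier stands for the power series Σ_t g t · zᵗ; shift g s is zˢ · g.
  shift : (ℕ → Carrier) → ℕ → ℕ → Carrier
  shift g zero    t       = g t
  shift g (suc s) zero    = 0#
  shift g (suc s) (suc t) = shift g s t

  shift-within : ∀ g {s t} → s ≤ t → shift g s t ≡ g (t ∸ s)
  shift-within g {zero}  _         = ≡.refl
  shift-within g {suc s} (s≤s s≤t) = shift-within g s≤t

  shift-beyond : ∀ g {s t} → t < s → shift g s t ≡ 0#
  shift-beyond g {suc s} {zero}  _         = ≡.refl
  shift-beyond g {suc s} {suc t} (s≤s t<s) = shift-beyond g t<s

  shift-cong : ∀ {g h} s t → (∀ t′ → t′ ≤ t → g t′ ≈ h t′) → shift g s t ≈ shift h s t
  shift-cong zero    t       g≈h = g≈h t ≤-refl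
  shift-cong (suc s) zero    g≈h = refl
  shift-cong (suc s) (suc t) g≈h = shift-cong s t (λ t′ t′≤t → g≈h t′ (≤-trans t′≤t (n≤1+n t)))

  shift-shift : ∀ g r s t → shift (shift g r) s t ≡ shift g (s ℕ.+ r) t
  shift-shift g r zero    t       = ≡.refl
  shift-shift g r (suc s) zero    = ≡.refl
  shift-shift g r (suc s) (suc t) = shift-shift g r s t

  shift-comm : ∀ g r s t → shift (shift g r) s t ≡ shift (shift g s) r t
  shift-comm g r s t = ≡.trans (shift-shift g r s t)
    (≡.trans (≡.cong (λ u → shift g u t) (ℕₚ.+-comm s r)) (≡.sym (shift-shift g s r t)))

  shift-0# : ∀ s t → shift (λ _ → 0#) s t ≈ 0#
  shift-0# zero    t       = refl
  shift-0# (suc s) zero    = refl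
  shift-0# (suc s) (suc t) = shift-0# s t

  shift-+ : ∀ g h s t → shift (λ t′ → g t′ + h t′) s t ≈ shift g s t + shift h s t
  shift-+ g h zero    t       = refl
  shift-+ g h (suc s) zero    = sym (+-identityˡ 0#)
  shift-+ g h (suc s) (suc t) = shift-+ g h s t

  *-shift : ∀ u g s t → u * shift g s t ≈ shift (λ t′ → u * g t′) s t
  *-shift u g zero    t       = refl
  *-shift u g (suc s) zero    = zeroʳ u
  *-shift u g (suc s) (suc t) = *-shift u g s t

  iverson-shift : ∀ b g s t → iverson b (shift g s t) ≈ shift (λ t′ → iverson b (g t′)) s t
  iverson-shift true  g s t = refl
  iverson-shift false g s t = sym (shift-0# s t)

  iverson-+≡ᵇ-shift : ∀ i w t z → iverson (i ℕ.+ w ≡ᵇ t) z ≡ shift (λ t′ → iverson (w ≡ᵇ t′) z) i t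
  iverson-+≡ᵇ-shift zero    w t       z = ≡.refl
  iverson-+≡ᵇ-shift (suc i) w zero    z = ≡.refl
  iverson-+≡ᵇ-shift (suc i) w (suc t) z = iverson-+≡ᵇ-shift i w t z

  shift-sumBelow : ∀ n (G : ℕ → ℕ → Carrier) s t →
    shift (λ t′ → sumBelow n (λ l → G l t′)) s t ≈ sumBelow n (λ l → shift (G l) s t)
  shift-sumBelow zero    G s t = shift-0# s t
  shift-sumBelow (suc n) G s t =
    trans (shift-+ (G 0) (λ t′ → sumBelow n (λ l → G (suc l) t′)) s t)
          (+-congˡ (shift-sumBelow n (G ∘ suc) s t))

  shift-rsum : ∀ {A : Set} (G : A → ℕ → Carrier) as s t →
    shift (λ t′ → rsum R (map (λ a → G a t′) as)) s t ≈ rsum R (map (λ a → shift (G a) s t) as)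
  shift-rsum G []       s t = shift-0# s t
  shift-rsum G (a ∷ as) s t =
    trans (shift-+ (G a) (λ t′ → rsum R (map (λ a → G a t′) as)) s t) (+-congˡ (shift-rsum G as s t))

  compositionSum : (ℕ → Carrier) → (b k t : ℕ) → Carrier
  compositionSum f b k t = rsum R (map (λ π → iverson (vsum π ≡ᵇ t) (vprod R f π)) (vecsUpTo k b))

  compositionSum-suc : ∀ f b k t →
    compositionSum f b (suc k) t ≈ sumBelow (suc b) (λ s → f s * shift (compositionSum f b k) s t)
  compositionSum-suc f b k t =
    trans (rsum-vecsUpTo-suc k b _) (sumBelow-cong (suc b) (λ s _ → firstEntry s))
    where
      firstEntry : ∀ s → rsum R (map (λ π → iverson (s ℕ.+ vsum π ≡ᵇ t) (f s * vprod R f π)) (vecsUpTo k b))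
                        ≈ f s * shift (compositionSum f b k) s t
      firstEntry s = begin
        rsum R (map (λ π → iverson (s ℕ.+ vsum π ≡ᵇ t) (f s * vprod R f π)) (vecsUpTo k b))
          ≡⟨ ≡.cong (rsum R) (map-cong (λ π → iverson-+≡ᵇ-shift s (vsum π) t _) (vecsUpTo k b)) ⟩
        rsum R (map (λ π → shift (λ t′ → iverson (vsum π ≡ᵇ t′) (f s * vprod R f π)) s t) (vecsUpTo k b))
          ≈⟨ shift-rsum (λ π t′ → iverson (vsum π ≡ᵇ t′) (f s * vprod R f π)) (vecsUpTo k b) s t ⟨
        shift (λ t′ → rsum R (map (λ π → iverson (vsum π ≡ᵇ t′) (f s * vprod R f π)) (vecsUpTo k b))) s t
          ≈⟨ shift-cong s t (λ t′ _ → pullWeight t′) ⟩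
        shift (λ t′ → f s * compositionSum f b k t′) s t
          ≈⟨ *-shift (f s) (compositionSum f b k) s t ⟨
        f s * shift (compositionSum f b k) s t ∎
        where
          pullWeight : ∀ t′ → rsum R (map (λ π → iverson (vsum π ≡ᵇ t′) (f s * vprod R f π)) (vecsUpTo k b))
                              ≈ f s * compositionSum f b k t′
          pullWeight t′ = trans (rsum-cong (vecsUpTo k b) (λ π → sym (*-iverson (vsum π ≡ᵇ t′) (f s) _)))
                                (sym (*-distribˡ-rsum (f s) _ (vecsUpTo k b)))

  -- coeff j l are the coefficients of a series e(w) = Σ_l coeff j l · wˡ with e(0) = 1 and
  -- e′ = y_{j+1} · e, i.e. of exp(y_{j+1} w).
  module DividedPowers (y : ℕ → Carrier) (coeff : ℕ → ℕ → Carrier)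
    (coeff-zero : ∀ j → coeff j 0 ≈ 1#)
    (coeff-suc : ∀ j l → y (suc j) * coeff j l ≈ ι R (suc l) * coeff j (suc l)) where

    mulPoly : ℕ → ℕ → (ℕ → Carrier) → ℕ → Carrier
    mulPoly j m g t = sumBelow m (λ i → y (suc j ℕ.+ i) * shift g (suc j ℕ.+ i) t)

    -- dividedPower j m k t is the coefficient of zᵗ in (Σ_{s=j+1}^{j+m} y_s zˢ)ᵏ / k!, expanded
    -- via γ_k(a + b) = Σ_l γ_l(a) γ_{k-l}(b) and γ_l(y_{j+1} z^{j+1}) = coeff j l · z^{(j+1)l}.
    dividedPower : ℕ → ℕ → ℕ → ℕ → Carrier
    dividedPower j zero    k t = iverson (0 ≡ᵇ k) (iverson (0 ≡ᵇ t) 1#)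
    dividedPower j (suc m) k t =
      sumBelow (suc k) (λ l → coeff j l * shift (dividedPower (suc j) m (k ∸ l)) (suc j ℕ.* l) t)

    mulPoly-suc : ∀ j m g t →
      mulPoly j (suc m) g t ≈ y (suc j) * shift g (suc j) t + mulPoly (suc j) m g t
    mulPoly-suc j m g t =
      +-cong (reflexive (≡.cong term (ℕₚ.+-identityʳ (suc j))))
             (sumBelow-cong m (λ i _ → reflexive (≡.cong term (+-suc (suc j) i))))
      where
        term : ℕ → Carrier
        term s = y s * shift g s t

    mulPoly-cong : ∀ j m {g h} t → (∀ t′ → t′ ≤ t → g t′ ≈ h t′) → mulPoly j m g t ≈ mulPoly j m h t
    mulPoly-cong j m t g≈h = sumBelow-cong m (λ i _ → *-congˡ (shift-cong (suc j ℕ.+ i) t g≈h))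

    *-mulPoly : ∀ j m u g t → u * mulPoly j m g t ≈ mulPoly j m (λ t′ → u * g t′) t
    *-mulPoly j m u g t = trans (*-distribˡ-sumBelow m u _) (sumBelow-cong m (λ i _ →
      trans (x*yz≈y*xz u _ _) (*-congˡ (*-shift u g (suc j ℕ.+ i) t))))

    mulPoly-sumBelow : ∀ j m n (G : ℕ → ℕ → Carrier) t →
      mulPoly j m (λ t′ → sumBelow n (λ l → G l t′)) t ≈ sumBelow n (λ l → mulPoly j m (G l) t)
    mulPoly-sumBelow j m n G t = begin
      mulPoly j m (λ t′ → sumBelow n (λ l → G l t′)) t
        ≈⟨ sumBelow-cong m (λ i _ → *-congˡ (shift-sumBelow n G (suc j ℕ.+ i) t)) ⟩
      sumBelow m (λ i → y (suc j ℕ.+ i) * sumBelow n (λ l → shift (G l) (suc j ℕ.+ i) t))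
        ≈⟨ sumBelow-cong m (λ i _ → *-distribˡ-sumBelow n _ _) ⟩
      sumBelow m (λ i → sumBelow n (λ l → y (suc j ℕ.+ i) * shift (G l) (suc j ℕ.+ i) t))
        ≈⟨ sumBelow-comm m n _ ⟩
      sumBelow n (λ l → mulPoly j m (G l) t) ∎

    mulPoly-shift : ∀ j m g r t → shift (mulPoly j m g) r t ≈ mulPoly j m (shift g r) t
    mulPoly-shift j m g r t = begin
      shift (mulPoly j m g) r t
        ≈⟨ shift-sumBelow m (λ i t′ → y (suc j ℕ.+ i) * shift g (suc j ℕ.+ i) t′) r t ⟩
      sumBelow m (λ i → shift (λ t′ → y (suc j ℕ.+ i) * shift g (suc j ℕ.+ i) t′) r t)
        ≈⟨ sumBelow-cong m (λ i _ → sym (*-shift _ (shift g (suc j ℕ.+ i)) r t)) ⟩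
      sumBelow m (λ i → y (suc j ℕ.+ i) * shift (shift g (suc j ℕ.+ i)) r t)
        ≈⟨ sumBelow-cong m (λ i _ → reflexive (≡.cong (y (suc j ℕ.+ i) *_) (shift-comm g (suc j ℕ.+ i) r t))) ⟩
      mulPoly j m (shift g r) t ∎

    dividedPower-zero : ∀ j m t → dividedPower j m 0 t ≈ iverson (0 ≡ᵇ t) 1#
    dividedPower-zero j zero    t = refl
    dividedPower-zero j (suc m) t = begin
      coeff j 0 * shift (dividedPower (suc j) m 0) (suc j ℕ.* 0) t + 0#
        ≈⟨ +-identityʳ _ ⟩
      coeff j 0 * shift (dividedPower (suc j) m 0) (suc j ℕ.* 0) t
        ≡⟨ ≡.cong (λ s → coeff j 0 * shift (dividedPower (suc j) m 0) s t) (*-zeroʳ (suc j)) ⟩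
      coeff j 0 * dividedPower (suc j) m 0 t
        ≈⟨ *-cong (coeff-zero j) (dividedPower-zero (suc j) m t) ⟩
      1# * iverson (0 ≡ᵇ t) 1#
        ≈⟨ *-identityˡ _ ⟩
      iverson (0 ≡ᵇ t) 1# ∎

    -- The factor k+1 = l + (k+1-l) is split between the first variable (whose exponent is l)
    -- and the remaining ones (handled by induction on m).
    dividedPower-suc : ∀ j m k t → ι R (suc k) * dividedPower j m (suc k) t ≈ mulPoly j m (dividedPower j m k) t
    dividedPower-suc j zero    k t = zeroʳ _
    dividedPower-suc j (suc m) k t = begin
      ι R (suc k) * sumBelow (suc (suc k)) T
        ≈⟨ *-distribˡ-sumBelow (suc (suc k)) (ι R (suc k)) T ⟩
      sumBelow (suc (suc k)) (λ l → ι R (suc k) * T l)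
        ≈⟨ sumBelow-cong (suc (suc k)) (λ l l<k+2 → splitFactor l (≤-pred l<k+2)) ⟩
      sumBelow (suc (suc k)) (λ l → ι R l * T l + ι R (suc k ∸ l) * T l)
        ≈⟨ sumBelow-+ (suc (suc k)) (λ l → ι R l * T l) (λ l → ι R (suc k ∸ l) * T l) ⟩
      sumBelow (suc (suc k)) (λ l → ι R l * T l) + sumBelow (suc (suc k)) (λ l → ι R (suc k ∸ l) * T l)
        ≈⟨ +-cong firstVariable otherVariables ⟩
      y a * shift (dividedPower j (suc m) k) a t + mulPoly a m (dividedPower j (suc m) k) t
        ≈⟨ mulPoly-suc j m (dividedPower j (suc m) k) t ⟨
      mulPoly j (suc m) (dividedPower j (suc m) k) t ∎
      where
        a : ℕ
        a = suc j
        T : ℕ → Carrier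
        T l = coeff j l * shift (dividedPower a m (suc k ∸ l)) (a ℕ.* l) t
        G : ℕ → ℕ → Carrier
        G l t′ = coeff j l * shift (dividedPower a m (k ∸ l)) (a ℕ.* l) t′

        splitFactor : ∀ l → l ≤ suc k → ι R (suc k) * T l ≈ ι R l * T l + ι R (suc k ∸ l) * T l
        splitFactor l l≤k+1 = trans (*-congʳ (trans (reflexive (≡.cong (ι R) (≡.sym (m+[n∸m]≡n l≤k+1))))
                                                    (ι-+ l (suc k ∸ l))))
                                    (distribʳ _ _ _)

        raiseExponent : ∀ l → ι R (suc l) * T (suc l) ≈ y a * shift (G l) a t
        raiseExponent l = begin
          ι R (suc l) * (coeff j (suc l) * S)    ≈⟨ *-assoc _ _ _ ⟨
          (ι R (suc l) * coeff j (suc l)) * S    ≈⟨ *-congʳ (coeff-suc j l) ⟨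
          (y a * coeff j l) * S                  ≈⟨ *-assoc _ _ _ ⟩
          y a * (coeff j l * S)
            ≡⟨ ≡.cong (λ s → y a * (coeff j l * shift (dividedPower a m (k ∸ l)) s t)) (*-suc a l) ⟩
          y a * (coeff j l * shift (dividedPower a m (k ∸ l)) (a ℕ.+ a ℕ.* l) t)
            ≡⟨ ≡.cong (λ z → y a * (coeff j l * z)) (shift-shift (dividedPower a m (k ∸ l)) (a ℕ.* l) a t) ⟨
          y a * (coeff j l * shift (shift (dividedPower a m (k ∸ l)) (a ℕ.* l)) a t)
            ≈⟨ *-congˡ (*-shift (coeff j l) _ a t) ⟩
          y a * shift (G l) a t ∎
          where
            S : Carrier
            S = shift (dividedPower a m (k ∸ l)) (a ℕ.* suc l) t

        firstVariable : sumBelow (suc (suc k)) (λ l → ι R l * T l) ≈ y a * shift (dividedPower j (suc m) k) a t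
        firstVariable = begin
          0# * T 0 + sumBelow (suc k) (λ l → ι R (suc l) * T (suc l))
            ≈⟨ trans (+-congʳ (zeroˡ _)) (+-identityˡ _) ⟩
          sumBelow (suc k) (λ l → ι R (suc l) * T (suc l))
            ≈⟨ sumBelow-cong (suc k) (λ l _ → raiseExponent l) ⟩
          sumBelow (suc k) (λ l → y a * shift (G l) a t)
            ≈⟨ *-distribˡ-sumBelow (suc k) (y a) (λ l → shift (G l) a t) ⟨
          y a * sumBelow (suc k) (λ l → shift (G l) a t)
            ≈⟨ *-congˡ (shift-sumBelow (suc k) G a t) ⟨
          y a * shift (dividedPower j (suc m) k) a t ∎

        useInduction : ∀ l → l ≤ k → ι R (suc k ∸ l) * T l ≈ coeff j l * shift (mulPoly a m (dividedPower a m (k ∸ l))) (a ℕ.* l) t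
        useInduction l l≤k = begin
          ι R (suc k ∸ l) * T l
            ≡⟨ ≡.cong (λ n → ι R n * (coeff j l * shift (dividedPower a m n) (a ℕ.* l) t)) (+-∸-assoc 1 l≤k) ⟩
          ι R (suc (k ∸ l)) * (coeff j l * shift (dividedPower a m (suc (k ∸ l))) (a ℕ.* l) t)
            ≈⟨ x*yz≈y*xz _ _ _ ⟩
          coeff j l * (ι R (suc (k ∸ l)) * shift (dividedPower a m (suc (k ∸ l))) (a ℕ.* l) t)
            ≈⟨ *-congˡ (*-shift _ _ (a ℕ.* l) t) ⟩
          coeff j l * shift (λ t′ → ι R (suc (k ∸ l)) * dividedPower a m (suc (k ∸ l)) t′) (a ℕ.* l) t
            ≈⟨ *-congˡ (shift-cong (a ℕ.* l) t (λ t′ _ → dividedPower-suc a m (k ∸ l) t′)) ⟩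
          coeff j l * shift (mulPoly a m (dividedPower a m (k ∸ l))) (a ℕ.* l) t ∎

        otherVariables : sumBelow (suc (suc k)) (λ l → ι R (suc k ∸ l) * T l) ≈ mulPoly a m (dividedPower j (suc m) k) t
        otherVariables = begin
          sumBelow (suc (suc k)) (λ l → ι R (suc k ∸ l) * T l)
            ≈⟨ sumBelow-truncate (λ l → ι R (suc k ∸ l) * T l) (n≤1+n (suc k)) (λ l k+1≤l _ →
                 trans (*-congʳ (reflexive (≡.cong (ι R) (m≤n⇒m∸n≡0 k+1≤l)))) (zeroˡ _)) ⟩
          sumBelow (suc k) (λ l → ι R (suc k ∸ l) * T l)
            ≈⟨ sumBelow-cong (suc k) (λ l l<k+1 → useInduction l (≤-pred l<k+1)) ⟩
          sumBelow (suc k) (λ l → coeff j l * shift (mulPoly a m (dividedPower a m (k ∸ l))) (a ℕ.* l) t)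
            ≈⟨ sumBelow-cong (suc k) (λ l _ → *-congˡ {coeff j l} (mulPoly-shift a m (dividedPower a m (k ∸ l)) (a ℕ.* l) t)) ⟩
          sumBelow (suc k) (λ l → coeff j l * mulPoly a m (shift (dividedPower a m (k ∸ l)) (a ℕ.* l)) t)
            ≈⟨ sumBelow-cong (suc k) (λ l _ → *-mulPoly a m (coeff j l) (shift (dividedPower a m (k ∸ l)) (a ℕ.* l)) t) ⟩
          sumBelow (suc k) (λ l → mulPoly a m (G l) t)
            ≈⟨ mulPoly-sumBelow a m (suc k) G t ⟨
          mulPoly a m (dividedPower j (suc m) k) t ∎

    module SupportedWeight (M : ℕ) (w : ℕ → Carrier) (w-zero : w 0 ≈ 0#)
      (w-on : ∀ i → i < M → w (suc i) ≈ y (suc i)) (w-off : ∀ i → M ≤ i → w (suc i) ≈ 0#) where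

      convolution≈mulPoly : ∀ b g t → t ≤ b → sumBelow (suc b) (λ s → w s * shift g s t) ≈ mulPoly 0 M g t
      convolution≈mulPoly b g t t≤b = begin
        w 0 * g t + sumBelow b W
          ≈⟨ trans (+-congʳ (trans (*-congʳ w-zero) (zeroˡ _))) (+-identityˡ _) ⟩
        sumBelow b W
          ≈⟨ sumBelow-truncate W (m≤m+n b M) (λ i b≤i _ → beyondTarget i b≤i) ⟨
        sumBelow (b ℕ.+ M) W
          ≈⟨ sumBelow-truncate W (m≤n+m M b) (λ i M≤i _ → trans (*-congʳ (w-off i M≤i)) (zeroˡ _)) ⟩
        sumBelow M W
          ≈⟨ sumBelow-cong M (λ i i<M → *-congʳ (w-on i i<M)) ⟩
        mulPoly 0 M g t ∎
        where
          W : ℕ → Carrier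
          W i = w (suc i) * shift g (suc i) t
          beyondTarget : ∀ i → b ≤ i → W i ≈ 0#
          beyondTarget i b≤i = trans (*-congˡ (reflexive (shift-beyond g (s≤s (≤-trans t≤b b≤i))))) (zeroʳ _)

      compositionSum≈dividedPower : ∀ b k t → t ≤ b → compositionSum w b k t ≈ ι R (k !) * dividedPower 0 M k t
      compositionSum≈dividedPower b zero    t t≤b = begin
        iverson (0 ≡ᵇ t) 1# + 0#            ≈⟨ +-identityʳ _ ⟩
        iverson (0 ≡ᵇ t) 1#                 ≈⟨ dividedPower-zero 0 M t ⟨
        dividedPower 0 M 0 t                ≈⟨ *-identityˡ _ ⟨
        1# * dividedPower 0 M 0 t           ≈⟨ *-congʳ (+-identityʳ 1#) ⟨
        ι R (0 !) * dividedPower 0 M 0 t    ∎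
      compositionSum≈dividedPower b (suc k) t t≤b = begin
        compositionSum w b (suc k) t
          ≈⟨ compositionSum-suc w b k t ⟩
        sumBelow (suc b) (λ s → w s * shift (compositionSum w b k) s t)
          ≈⟨ convolution≈mulPoly b (compositionSum w b k) t t≤b ⟩
        mulPoly 0 M (compositionSum w b k) t
          ≈⟨ mulPoly-cong 0 M t (λ t′ t′≤t → compositionSum≈dividedPower b k t′ (≤-trans t′≤t t≤b)) ⟩
        mulPoly 0 M (λ t′ → ι R (k !) * dividedPower 0 M k t′) t
          ≈⟨ *-mulPoly 0 M (ι R (k !)) (dividedPower 0 M k) t ⟨
        ι R (k !) * mulPoly 0 M (dividedPower 0 M k) t
          ≈⟨ *-congˡ (dividedPower-suc 0 M k t) ⟨
        ι R (k !) * (ι R (suc k) * dividedPower 0 M (suc k) t)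
          ≈⟨ x*yz≈y*xz _ _ _ ⟩
        ι R (suc k) * (ι R (k !) * dividedPower 0 M (suc k) t)
          ≈⟨ *-assoc _ _ _ ⟨
        (ι R (suc k) * ι R (k !)) * dividedPower 0 M (suc k) t
          ≈⟨ *-congʳ (ι-* (suc k) (k !)) ⟨
        ι R (suc k !) * dividedPower 0 M (suc k) t ∎

module BellPolynomial {c ℓ : Level} (R : CommutativeRing c ℓ) (inv : ℕ → CommutativeRing.Carrier R)
  (inv-correct : ∀ m → CommutativeRing._≈_ R (CommutativeRing._*_ R (ι R (suc m)) (inv m)) (CommutativeRing.1# R))
  (x : ℕ → CommutativeRing.Carrier R) where
  open CommutativeRing R
  open WithInverses R inv
  open import Algebra.Properties.CommutativeSemigroup *-commutativeSemigroup
    using () renaming (x∙yz≈y∙xz to x*yz≈y*xz)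
  open import Relation.Binary.Reasoning.Setoid setoid

  ι!*recip! : ∀ n → ι R (n !) * recip (n !) ≈ 1#
  ι!*recip! n = ≡.subst (λ m → ι R m * recip (n !) ≈ 1#) (suc-pred (n !) ⦃ n !≢0 ⦄) (inv-correct (pred (n !)))

  recip!-cancel : ∀ n z → recip (n !) * (ι R (n !) * z) ≈ z
  recip!-cancel n z = begin
    recip (n !) * (ι R (n !) * z)   ≈⟨ *-assoc _ _ _ ⟨
    (recip (n !) * ι R (n !)) * z   ≈⟨ *-congʳ (trans (*-comm _ _) (ι!*recip! n)) ⟩
    1# * z                          ≈⟨ *-identityˡ z ⟩
    z                               ∎

  recip!-suc : ∀ l → recip (l !) ≈ ι R (suc l) * recip (suc l !)
  recip!-suc l = begin
    recip (l !)                                                ≈⟨ *-identityʳ _ ⟨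
    recip (l !) * 1#                                           ≈⟨ *-congˡ (ι!*recip! (suc l)) ⟨
    recip (l !) * (ι R (suc l !) * recip (suc l !))            ≈⟨ *-congˡ (*-congʳ (trans (ι-* R (suc l) (l !)) (*-comm _ _))) ⟩
    recip (l !) * ((ι R (l !) * ι R (suc l)) * recip (suc l !)) ≈⟨ *-congˡ (*-assoc _ _ _) ⟩
    recip (l !) * (ι R (l !) * (ι R (suc l) * recip (suc l !))) ≈⟨ recip!-cancel l _ ⟩
    ι R (suc l) * recip (suc l !)                              ∎

  y : ℕ → Carrier
  y s = x s * recip (s !)

  coeff : ℕ → ℕ → Carrier
  coeff j l = recip (l !) * pow R (y (suc j)) l

  coeff-zero : ∀ j → coeff j 0 ≈ 1#
  coeff-zero j = trans (*-identityʳ _) (trans (sym (*-identityˡ _)) (trans (*-congʳ (sym (+-identityʳ 1#))) (inv-correct 0)))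

  coeff-suc : ∀ j l → y (suc j) * coeff j l ≈ ι R (suc l) * coeff j (suc l)
  coeff-suc j l = begin
    y (suc j) * (recip (l !) * pow R (y (suc j)) l)
      ≈⟨ x*yz≈y*xz _ _ _ ⟩
    recip (l !) * (y (suc j) * pow R (y (suc j)) l)
      ≈⟨ *-congʳ (recip!-suc l) ⟩
    (ι R (suc l) * recip (suc l !)) * pow R (y (suc j)) (suc l)
      ≈⟨ *-assoc _ _ _ ⟩
    ι R (suc l) * coeff j (suc l) ∎

  open DividedPowers R y coeff coeff-zero coeff-suc public

  bellSum : (j m b k t : ℕ) → Carrier
  bellSum j m b k t =
    rsum R (map (λ ℓs → iverson R (vsum ℓs ≡ᵇ k) (iverson R (wsumFrom j ℓs ≡ᵇ t) (bellTermFrom j x ℓs))) (vecsUpTo m b))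

  bellSum-suc : ∀ j m b k t → bellSum j (suc m) b k t
    ≈ sumBelow R (suc b) (λ l → shift R (λ k′ → coeff j l * shift R (bellSum (suc j) m b k′) (suc j ℕ.* l) t) l k)
  bellSum-suc j m b k t = trans (rsum-vecsUpTo-suc R m b _) (sumBelow-cong R (suc b) (λ l _ → firstExponent l))
    where
      a : ℕ
      a = suc j
      vs : List (Vec ℕ m)
      vs = vecsUpTo m b
      H : ℕ → Vec ℕ m → ℕ → Carrier
      H l ℓs t′ = iverson R (wsumFrom a ℓs ≡ᵇ t′) (coeff j l * bellTermFrom a x ℓs)

      pullCoefficient : ∀ l k′ → rsum R (map (λ ℓs → iverson R (vsum ℓs ≡ᵇ k′) (shift R (H l ℓs) (a ℕ.* l) t)) vs)
                                 ≈ coeff j l * shift R (bellSum a m b k′) (a ℕ.* l) t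
      pullCoefficient l k′ = begin
        rsum R (map (λ ℓs → iverson R (vsum ℓs ≡ᵇ k′) (shift R (H l ℓs) (a ℕ.* l) t)) vs)
          ≈⟨ rsum-cong R vs (λ ℓs → iverson-shift R _ (H l ℓs) (a ℕ.* l) t) ⟩
        rsum R (map (λ ℓs → shift R (λ t′ → iverson R (vsum ℓs ≡ᵇ k′) (H l ℓs t′)) (a ℕ.* l) t) vs)
          ≈⟨ shift-rsum R (λ ℓs t′ → iverson R (vsum ℓs ≡ᵇ k′) (H l ℓs t′)) vs (a ℕ.* l) t ⟨
        shift R (λ t′ → rsum R (map (λ ℓs → iverson R (vsum ℓs ≡ᵇ k′) (H l ℓs t′)) vs)) (a ℕ.* l) t
          ≈⟨ shift-cong R (a ℕ.* l) t (λ t′ _ → trans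
               (rsum-cong R vs (λ ℓs → sym (*-iverson² R (vsum ℓs ≡ᵇ k′) (wsumFrom a ℓs ≡ᵇ t′) (coeff j l) (bellTermFrom a x ℓs))))
               (sym (*-distribˡ-rsum R (coeff j l) (λ ℓs → iverson R (vsum ℓs ≡ᵇ k′) (iverson R (wsumFrom a ℓs ≡ᵇ t′) (bellTermFrom a x ℓs))) vs))) ⟩
        shift R (λ t′ → coeff j l * bellSum a m b k′ t′) (a ℕ.* l) t
          ≈⟨ *-shift R (coeff j l) (bellSum a m b k′) (a ℕ.* l) t ⟨
        coeff j l * shift R (bellSum a m b k′) (a ℕ.* l) t ∎

      firstExponent : ∀ l →
        rsum R (map (λ ℓs → iverson R (l ℕ.+ vsum ℓs ≡ᵇ k)
                              (iverson R (a ℕ.* l ℕ.+ wsumFrom a ℓs ≡ᵇ t) (coeff j l * bellTermFrom a x ℓs))) vs)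
        ≈ shift R (λ k′ → coeff j l * shift R (bellSum a m b k′) (a ℕ.* l) t) l k
      firstExponent l = begin
        _ ≡⟨ ≡.cong (rsum R) (map-cong (λ ℓs → ≡.trans
               (≡.cong (iverson R (l ℕ.+ vsum ℓs ≡ᵇ k)) (iverson-+≡ᵇ-shift R (a ℕ.* l) (wsumFrom a ℓs) t _))
               (iverson-+≡ᵇ-shift R l (vsum ℓs) k _)) vs) ⟩
        rsum R (map (λ ℓs → shift R (λ k′ → iverson R (vsum ℓs ≡ᵇ k′) (shift R (H l ℓs) (a ℕ.* l) t)) l k) vs)
          ≈⟨ shift-rsum R (λ ℓs k′ → iverson R (vsum ℓs ≡ᵇ k′) (shift R (H l ℓs) (a ℕ.* l) t)) vs l k ⟨
        shift R (λ k′ → rsum R (map (λ ℓs → iverson R (vsum ℓs ≡ᵇ k′) (shift R (H l ℓs) (a ℕ.* l) t)) vs)) l k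
          ≈⟨ shift-cong R l k (λ k′ _ → pullCoefficient l k′) ⟩
        shift R (λ k′ → coeff j l * shift R (bellSum a m b k′) (a ℕ.* l) t) l k ∎

  -- Entries of an index vector are bounded by their sum k, so the enumeration bound b ≥ k is harmless.
  bellSum≈dividedPower : ∀ m j {b} k t → k ≤ b ⊎ m ≡ 0 → bellSum j m b k t ≈ dividedPower j m k t
  bellSum≈dividedPower zero    j k t _          = +-identityʳ _
  bellSum≈dividedPower (suc m) j {b} k t (inj₁ k≤b) = begin
    bellSum j (suc m) b k t
      ≈⟨ bellSum-suc j m b k t ⟩
    sumBelow R (suc b) (λ l → shift R (G l) l k)
      ≈⟨ sumBelow-truncate R (λ l → shift R (G l) l k) (s≤s k≤b) (λ l k<l _ → reflexive (shift-beyond R (G l) k<l)) ⟩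
    sumBelow R (suc k) (λ l → shift R (G l) l k)
      ≈⟨ sumBelow-cong R (suc k) (λ l l≤k → reflexive (shift-within R (G l) (≤-pred l≤k))) ⟩
    sumBelow R (suc k) (λ l → coeff j l * shift R (bellSum (suc j) m b (k ∸ l)) (suc j ℕ.* l) t)
      ≈⟨ sumBelow-cong R (suc k) (λ l _ → *-congˡ {coeff j l} (shift-cong R (suc j ℕ.* l) t (λ t′ _ →
           bellSum≈dividedPower m (suc j) (k ∸ l) t′ (inj₁ (≤-trans (m∸n≤m k l) k≤b))))) ⟩
    dividedPower j (suc m) k t ∎
    where
      G : ℕ → ℕ → Carrier
      G l k′ = coeff j l * shift R (bellSum (suc j) m b k′) (suc j ℕ.* l) t

  partialBell≈bellSum : ∀ n k → partialBell n k x ≈ ι R (n !) * bellSum 0 (bellArity n k) n k n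
  partialBell≈bellSum n k = begin
    partialBell n k x
      ≈⟨ rsum-filterᵇ R (λ ℓs → wsumFrom 0 ℓs ≡ᵇ n) term (filterᵇ (λ ℓs → vsum ℓs ≡ᵇ k) vs) ⟩
    rsum R (map (λ ℓs → iverson R (wsumFrom 0 ℓs ≡ᵇ n) (term ℓs)) (filterᵇ (λ ℓs → vsum ℓs ≡ᵇ k) vs))
      ≈⟨ rsum-filterᵇ R (λ ℓs → vsum ℓs ≡ᵇ k) _ vs ⟩
    rsum R (map (λ ℓs → iverson R (vsum ℓs ≡ᵇ k) (iverson R (wsumFrom 0 ℓs ≡ᵇ n) (term ℓs))) vs)
      ≈⟨ rsum-cong R vs (λ ℓs → sym (*-iverson² R (vsum ℓs ≡ᵇ k) (wsumFrom 0 ℓs ≡ᵇ n) (ι R (n !)) (bellTermFrom 0 x ℓs))) ⟩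
    rsum R (map (λ ℓs → ι R (n !) * iverson R (vsum ℓs ≡ᵇ k) (iverson R (wsumFrom 0 ℓs ≡ᵇ n) (bellTermFrom 0 x ℓs))) vs)
      ≈⟨ *-distribˡ-rsum R (ι R (n !)) (λ ℓs → iverson R (vsum ℓs ≡ᵇ k) (iverson R (wsumFrom 0 ℓs ≡ᵇ n) (bellTermFrom 0 x ℓs))) vs ⟨
    ι R (n !) * bellSum 0 (bellArity n k) n k n ∎
    where
      vs : List (Vec ℕ (bellArity n k))
      vs = vecsUpTo (bellArity n k) n
      term : Vec ℕ (bellArity n k) → Carrier
      term ℓs = ι R (n !) * bellTermFrom 0 x ℓs

  fWeight-on : ∀ n k i → i < bellArity n k → fWeight n k x (suc i) ≈ y (suc i)
  fWeight-on n k i i<M = reflexive (≡.cong (λ b → if b then y (suc i) else 0#)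
    (dec-true (suc i ℕ.+ k ≤? suc n) (s≤s (<bellArity⇒+≤ i<M))))

  fWeight-off : ∀ n k i → bellArity n k ≤ i → fWeight n k x (suc i) ≈ 0#
  fWeight-off n k i M≤i = reflexive (≡.cong (λ b → if b then y (suc i) else 0#)
    (dec-false (suc i ℕ.+ k ≤? suc n) (λ i+k<n+1 → <⇒≱ (+≤⇒<bellArity (≤-pred i+k<n+1)) M≤i)))

corollary1 : ∀ {c ℓ : Level} (R : CommutativeRing c ℓ)
    (inv : ℕ → CommutativeRing.Carrier R)
    → (∀ m → CommutativeRing._≈_ R (CommutativeRing._*_ R (ι R (suc m)) (inv m)) (CommutativeRing.1# R))
    → (x : ℕ → CommutativeRing.Carrier R) (k n : ℕ)
    → CommutativeRing._≈_ R
        (CommutativeRing._*_ R (CommutativeRing._*_ R (ι R (k !)) (WithInverses.recip R inv (n !)))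
          (WithInverses.partialBell R inv n k x))
        (weightedCompositions R (WithInverses.fWeight R inv n k x) k n)
corollary1 R inv inv-correct x k n = begin
  (ι R (k !) * recip (n !)) * partialBell n k x
    ≈⟨ *-congˡ (partialBell≈bellSum n k) ⟩
  (ι R (k !) * recip (n !)) * (ι R (n !) * bellSum 0 M n k n)
    ≈⟨ trans (*-assoc _ _ _) (*-congˡ (recip!-cancel n _)) ⟩
  ι R (k !) * bellSum 0 M n k n
    ≈⟨ *-congˡ (bellSum≈dividedPower M 0 k n (≤⊎bellArity≡0 n k)) ⟩
  ι R (k !) * dividedPower 0 M k n
    ≈⟨ compositionSum≈dividedPower n k n ≤-refl ⟨
  compositionSum R f n k n
    ≈⟨ rsum-filterᵇ R (λ π → vsum π ≡ᵇ n) (vprod R f) (vecsUpTo k n) ⟨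
  weightedCompositions R f k n ∎
  where
    open CommutativeRing R
    open WithInverses R inv
    open BellPolynomial R inv inv-correct x
    open import Relation.Binary.Reasoning.Setoid setoid
    M : ℕ
    M = bellArity n k
    f : ℕ → Carrier
    f = fWeight n k x
    open SupportedWeight M f refl (fWeight-on n k) (fWeight-off n k)
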